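{- Let $R$ be a finite commutative ring with identity which is not a field, and let $r$ be the minimum, over all $\gamma^o$-alliances $S'$ of $\Gamma(R)$, of the number of nilpotent elements of index $2$ (i.e. elements $x\neq 0$ with $x^2=0$) contained in the complement $Z(R)^*\setminus S'$. Then $$\gamma^o(\Gamma(\mathbb{Z}_2 \times R))\leq 1+ r + 2 \gamma^o(\Gamma(R)).$$ Moreover, the bound is sharp: equality holds for $R=\mathbb{Z}_8$.
   Context: $Z(R)^*$ denotes the set of nonzero zero-divisors of $R$. The zero-divisor graph $\Gamma(R)$ is the simple graph with vertex set $Z(R)^*$, in which distinct $u,v$ are adjacent if and only if $uv=0$. For a simple graph $\Gamma=(V,E)$, a set $S\subseteq V$ and a vertex $v$, let $\delta_S(v)$ be the number of neighbors of $v$ in $S$ and $\overline{S}=V\setminus S$. A nonempty set $S\subseteq V$ is a global offensive alliance if $\delta_S(v)\geq \delta_{\overline{S}}(v)+1$ for every $v\in\overline{S}$. $\gamma^o(\Gamma)$ is the minimum cardinality of a global offensive alliance of $\Gamma$, and a $\gamma^o$-alliance is a global offensive alliance of cardinality $\gamma^o(\Gamma)$. -}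

module Defs where

open import Level using (0ℓ)
open import Algebra.Bundles using (CommutativeRing)
import Algebra.Construct.DirectProduct as DP
open import Algebra.Structures using (IsCommutativeRing)
open import Data.Bool using (Bool; true; false)
open import Data.Nat using (ℕ; zero; suc; _≤_; NonZero)
import Data.Nat as ℕ
open import Data.Nat.DivMod using (_mod_)
open import Data.Fin as F using (Fin; toℕ)
import Data.Fin.Properties as FP
open import Data.Fin.Subset using (Subset; ∣_∣; Nonempty; ∁; _∩_; _∈_; _∉_)
open import Data.List using (List; []; _∷_; allFin; cartesianProduct; deduplicate; length; map; _++_)
open import Data.List.Relation.Unary.Any using (Any; here; there)
import Data.List.Relation.Unary.Any.Properties as AnyP
open import Data.List.Membership.Propositional.Properties using (∈-allFin)
import Data.Vec as V
open import Data.Product using (Σ; ∃; ∃-syntax; _×_; _,_; proj₁; proj₂)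
open import Data.Sum using (_⊎_; inj₁; inj₂)
open import Relation.Nullary using (¬_; Dec; yes; no; ¬?)
open import Relation.Nullary.Decidable using (does; True; toWitness; _×-dec_)
open import Relation.Binary using (Decidable)
open import Relation.Binary.PropositionalEquality using (_≡_; refl; cong; cong₂; isEquivalence)

-- A commutative ring (stdlib bundle, setoid equality _≈_) whose equality
-- is decidable and which comes with a list enumerating every element
-- (up to _≈_).  Finiteness = existence of such a complete list.

record FinCommRing : Set₁ where
  field
    ring : CommutativeRing 0ℓ 0ℓ
  open CommutativeRing ring public hiding (ring)
  field
    _≟_      : Decidable _≈_
    elements : List Carrier
    complete : ∀ x → Any (x ≈_) elements

module Graph (R : FinCommRing) where
  open FinCommRing R

  IsField : Set
  IsField = ¬ (1# ≈ 0#) × (∀ x → ¬ (x ≈ 0#) → ∃[ y ] (x * y ≈ 1#))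

  distinctElements : List Carrier
  distinctElements = deduplicate _≟_ elements

  IsVertex : Carrier → Set
  IsVertex x = ¬ (x ≈ 0#) × Any (λ y → ¬ (y ≈ 0#) × (x * y ≈ 0#)) elements

  isVertex? : (x : Carrier) → Dec (IsVertex x)
  isVertex? x = ¬? (x ≟ 0#) ×-dec
                Data.List.Relation.Unary.Any.any? (λ y → ¬? (y ≟ 0#) ×-dec ((x * y) ≟ 0#)) elements

  vertices : List Carrier
  vertices = Data.List.filter isVertex? distinctElements

  n : ℕ
  n = length vertices

  vtx : Fin n → Carrier
  vtx i = Data.List.lookup vertices i

  Adj : Carrier → Carrier → Set
  Adj u v = ¬ (u ≈ v) × (u * v ≈ 0#)

  adj? : (u v : Carrier) → Dec (Adj u v)
  adj? u v = ¬? (u ≟ v) ×-dec ((u * v) ≟ 0#)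

  N : Fin n → Subset n
  N i = V.tabulate (λ j → does (adj? (vtx i) (vtx j)))

  δ : Subset n → Fin n → ℕ
  δ S i = ∣ N i ∩ S ∣

  IsGOA : Subset n → Set
  IsGOA S = Nonempty S × (∀ i → i ∉ S → δ (∁ S) i ℕ.+ 1 ≤ δ S i)

  IsGammaO : ℕ → Set
  IsGammaO k = (∃[ S ] (IsGOA S × ∣ S ∣ ≡ k)) × (∀ S → IsGOA S → k ≤ ∣ S ∣)

  IsGammaOAlliance : Subset n → Set
  IsGammaOAlliance S = IsGOA S × (∀ S' → IsGOA S' → ∣ S ∣ ≤ ∣ S' ∣)

  -- nilpotent elements of index 2 among the vertices (x ≠ 0, x² = 0;
  -- every such x is automatically a vertex)
  nil2 : Subset n
  nil2 = V.tabulate (λ i → does ((vtx i * vtx i) ≟ 0#))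

  nil2Out : Subset n → ℕ
  nil2Out S = ∣ nil2 ∩ ∁ S ∣

  IsMinNil2 : ℕ → Set
  IsMinNil2 r = (∃[ S ] (IsGammaOAlliance S × nil2Out S ≡ r))
              × (∀ S → IsGammaOAlliance S → r ≤ nil2Out S)

module _ (A B : FinCommRing) where
  private
    module A = FinCommRing A
    module B = FinCommRing B

  private
    prodComplete : ∀ (a : A.Carrier) (b : B.Carrier) xs ys →
                   Any (a A.≈_) xs → Any (b B.≈_) ys →
                   Any (λ p → (a A.≈ proj₁ p) × (b B.≈ proj₂ p)) (cartesianProduct xs ys)
    prodComplete a b (x ∷ xs) ys (here ax) by =
      AnyP.++⁺ˡ (AnyP.map⁺ (Data.List.Relation.Unary.Any.map (λ bq → ax , bq) by))
    prodComplete a b (x ∷ xs) ys (there ax) by =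
      AnyP.++⁺ʳ (map (x ,_) ys) (prodComplete a b xs ys ax by)

  _×R_ : FinCommRing
  _×R_ = record
    { ring     = DP.commutativeRing A.ring B.ring
    ; _≟_      = λ p q → (proj₁ p A.≟ proj₁ q) ×-dec (proj₂ p B.≟ proj₂ q)
    ; elements = cartesianProduct A.elements B.elements
    ; complete = λ p → prodComplete (proj₁ p) (proj₂ p) A.elements B.elements
                          (A.complete (proj₁ p)) (B.complete (proj₂ p))
    }

module Zmod (m : ℕ) .{{_ : NonZero m}} where
  _+m_ _*m_ : Fin m → Fin m → Fin m
  x +m y = (toℕ x ℕ.+ toℕ y) mod m
  x *m y = (toℕ x ℕ.* toℕ y) mod m

  -m_ : Fin m → Fin m
  -m x = (m ℕ.∸ toℕ x) mod m

  0m 1m : Fin m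
  0m = 0 mod m
  1m = 1 mod m

  Laws : Set
  Laws = (∀ x y z → (x +m y) +m z ≡ x +m (y +m z))
       × (∀ x y → x +m y ≡ y +m x)
       × (∀ x → 0m +m x ≡ x)
       × (∀ x → x +m 0m ≡ x)
       × (∀ x → (-m x) +m x ≡ 0m)
       × (∀ x → x +m (-m x) ≡ 0m)
       × (∀ x y z → (x *m y) *m z ≡ x *m (y *m z))
       × (∀ x y → x *m y ≡ y *m x)
       × (∀ x → 1m *m x ≡ x)
       × (∀ x → x *m 1m ≡ x)
       × (∀ x y z → x *m (y +m z) ≡ (x *m y) +m (x *m z))
       × (∀ x y z → (y +m z) *m x ≡ (y *m x) +m (z *m x))

  private
    all1 : ∀ {P : Fin m → Set} → (∀ x → Dec (P x)) → Dec (∀ x → P x)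
    all1 = FP.all?
    all2 : ∀ {P : Fin m → Fin m → Set} → (∀ x y → Dec (P x y)) → Dec (∀ x y → P x y)
    all2 d = all1 (λ x → all1 (d x))
    all3 : ∀ {P : Fin m → Fin m → Fin m → Set} → (∀ x y z → Dec (P x y z)) → Dec (∀ x y z → P x y z)
    all3 d = all1 (λ x → all2 (d x))
    _≟m_ = FP._≟_ {m}

  laws? : Dec Laws
  laws? = all3 (λ x y z → ((x +m y) +m z) ≟m (x +m (y +m z)))
    ×-dec all2 (λ x y → (x +m y) ≟m (y +m x))
    ×-dec all1 (λ x → (0m +m x) ≟m x)
    ×-dec all1 (λ x → (x +m 0m) ≟m x)
    ×-dec all1 (λ x → ((-m x) +m x) ≟m 0m)
    ×-dec all1 (λ x → (x +m (-m x)) ≟m 0m)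
    ×-dec all3 (λ x y z → ((x *m y) *m z) ≟m (x *m (y *m z)))
    ×-dec all2 (λ x y → (x *m y) ≟m (y *m x))
    ×-dec all1 (λ x → (1m *m x) ≟m x)
    ×-dec all1 (λ x → (x *m 1m) ≟m x)
    ×-dec all3 (λ x y z → (x *m (y +m z)) ≟m ((x *m y) +m (x *m z)))
    ×-dec all3 (λ x y z → ((y +m z) *m x) ≟m ((y *m x) +m (z *m x)))

  mkRing : Laws → FinCommRing
  mkRing (a+ , c+ , il+ , ir+ , nl , nr , a* , c* , il* , ir* , dl , dr) = record
    { ring = record
      { Carrier = Fin m ; _≈_ = _≡_ ; _+_ = _+m_ ; _*_ = _*m_ ; -_ = -m_
      ; 0# = 0m ; 1# = 1m
      ; isCommutativeRing = record
        { isRing = record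
          { +-isAbelianGroup = record
            { isGroup = record
              { isMonoid = record
                { isSemigroup = record
                  { isMagma = record { isEquivalence = isEquivalence ; ∙-cong = cong₂ _+m_ }
                  ; assoc = a+ }
                ; identity = il+ , ir+ }
              ; inverse = nl , nr
              ; ⁻¹-cong = cong -m_ }
            ; comm = c+ }
          ; *-cong = cong₂ _*m_
          ; *-assoc = a*
          ; *-identity = il* , ir*
          ; distrib = dl , dr }
        ; *-comm = c* }
      }
    ; _≟_ = _≟m_
    ; elements = allFin m
    ; complete = λ x → ∈-allFin x
    }

ℤ₂ : FinCommRing
ℤ₂ = Zmod.mkRing 2 (toWitness {a? = Zmod.laws? 2} _)

ℤ₈ : FinCommRing
ℤ₈ = Zmod.mkRing 8 (toWitness {a? = Zmod.laws? 8} _)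

module Submission where

-- Let S be a γ^o-alliance of Γ(R) leaving exactly r index-2 nilpotents outside.  Then
--   S′ = {(1,0)} ∪ {0}×S ∪ {0}×{x ∉ S : x² = 0} ∪ {1}×S
-- is a global offensive alliance of Γ(ℤ₂ × R) of size 1 + r + 2γ^o(Γ(R)).  Outside S′ lie three kinds
-- of vertices.  For x regular, (0,x) is adjacent only to (1,0) among the vertices.  For x ∈ Z(R)* \ S
-- with x² ≠ 0, the neighbours of (0,x) are (1,0) and the two copies (0,v), (1,v) of each neighbour v
-- of x in Γ(R), so the offensive inequality of S at x doubles.  For x ∈ Z(R)* \ S, the neighbours of
-- (1,x) outside S′ are copies (0,v) of neighbours of x (here x² = 0 would put (0,x) into S′), so the
-- inequality of S at x carries over.
-- Sharpness for ℤ₈ is checked by exhausting the 2¹¹ subsets of the eleven vertices of Γ(ℤ₂ × ℤ₈).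

open import Defs

open import Data.Bool using (true; false; not; _∧_)
import Data.Bool as Bool
open import Data.Fin using (Fin; zero; suc)
import Data.Fin.Properties as Finₚ
open import Data.Fin.Subset using (Subset; ∣_∣; ∁; _∩_; _∈_; _∉_; Nonempty; ⁅_⁆; inside; outside)
open import Data.Fin.Subset.Properties
  using (_∈?_; nonempty?; anySubset?; ∣⁅x⁆∣≡1; x∈⁅y⁆⇒x≡y; p⊆q⇒∣p∣≤∣q∣)
open import Data.List using (List; []; _∷_; _++_; length; lookup; filter; map)
import Data.List.Properties as Listₚ
open import Data.List.Relation.Unary.All as All using (All; []; _∷_)
import Data.List.Relation.Unary.All.Properties as Allₚ
open import Data.List.Relation.Unary.AllPairs using ([]; _∷_)
open import Data.List.Relation.Unary.Any as Any using (here; there)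
import Data.List.Relation.Unary.Any.Properties as Anyₚ
import Data.List.Membership.Setoid as Membership
import Data.List.Membership.Setoid.Properties as Membershipₚ
open import Data.List.Membership.Setoid.Properties using (∈-++⁺ˡ; ∈-++⁺ʳ; ∈-++⁻; ∉⇒All[≉])
import Data.List.Membership.Propositional as PropMembership
import Data.List.Membership.Propositional.Properties as PropMembershipₚ
import Data.List.Relation.Binary.Disjoint.Setoid as Disjointness
import Data.List.Relation.Binary.Subset.Setoid as Sublist
import Data.List.Relation.Unary.Unique.Setoid as Unique
import Data.List.Relation.Unary.Unique.Setoid.Properties as Uniqueₚ
import Data.List.Relation.Unary.Unique.DecSetoid.Properties as DecUniqueₚ
open import Data.Nat as ℕ using (ℕ; suc; _+_; _≤_; _<_; z≤n)
import Data.Nat.Properties as ℕₚ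
open import Data.Product as Product using (_×_; _,_; ∃; ∃-syntax; proj₁; proj₂; uncurry)
open import Data.Sum as Sum using (_⊎_; inj₁; inj₂)
open import Data.Vec as V using (Vec; _∷_; [])
import Data.Vec.Properties as Vecₚ
open import Function using (_∘_)
open import Level using (Level; 0ℓ)
open import Relation.Binary using (Setoid; DecSetoid; _Respects_)
open import Relation.Binary.PropositionalEquality as ≡ using (_≡_)
open import Relation.Nullary using (¬_; yes; no; does; ¬?; contradiction)
open import Relation.Nullary.Decidable
  using (_×-dec_; _⊎-dec_; _→-dec_; decidable-stable; toWitness; toWitnessFalse)
open import Relation.Unary using (Pred; Decidable)

private variable a ℓ p : Level

module _ (S : Setoid a ℓ) where
  open Setoid S using (_≈_; sym)
  open Membership S using () renaming (_∈_ to _∈ₗ_)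
  open Unique S using (Unique)
  open Sublist S using (_⊆_)

  lookup-injective : ∀ {xs} → Unique xs → ∀ {i j} → lookup xs i ≈ lookup xs j → i ≡ j
  lookup-injective {_ ∷ _} _ {zero} {zero} _ = ≡.refl
  lookup-injective {_ ∷ _} (x∉xs ∷ _) {zero} {suc j} x≈ =
    contradiction x≈ (All.lookup x∉xs (PropMembershipₚ.∈-lookup j))
  lookup-injective {_ ∷ _} (x∉xs ∷ _) {suc i} {zero} ≈x =
    contradiction (sym ≈x) (All.lookup x∉xs (PropMembershipₚ.∈-lookup i))
  lookup-injective {_ ∷ _} (_ ∷ xs!) {suc i} {suc j} eq = ≡.cong suc (lookup-injective xs! eq)

  length-mono-⊆ : ∀ {xs ys} → Unique xs → xs ⊆ ys → length xs ≤ length ys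
  length-mono-⊆ {xs} xs! xs⊆ys = Finₚ.injective⇒≤ λ eq →
    lookup-injective xs! (Membershipₚ.index-injective S (xs⊆ys (∈-lookup _)) (xs⊆ys (∈-lookup _)) eq)
    where
    ∈-lookup : ∀ i → lookup xs i ∈ₗ xs
    ∈-lookup = Membershipₚ.∈-lookup S xs

  module _ {P : Pred (Setoid.Carrier S) p} (P? : Decidable P) (P-resp : P Respects _≈_) where

    length-filter-≤ : ∀ {xs ys} → Unique xs → (∀ {x} → x ∈ₗ xs → P x → x ∈ₗ ys) →
                      length (filter P? xs) ≤ length ys
    length-filter-≤ xs! into = length-mono-⊆ (Uniqueₚ.filter⁺ S P? xs!) λ x∈ →
      let x∈xs , Px = Membershipₚ.∈-filter⁻ S P? P-resp x∈ in into x∈xs Px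

    ≤-length-filter : ∀ {xs ys} → Unique ys → (∀ {y} → y ∈ₗ ys → y ∈ₗ xs × P y) →
                      length ys ≤ length (filter P? xs)
    ≤-length-filter ys! into = length-mono-⊆ ys! λ y∈ →
      let y∈xs , Py = into y∈ in Membershipₚ.∈-filter⁺ S P? P-resp y∈xs Py

∣p∣≡length∘filter : ∀ {A : Set a} {P : Pred A p} (P? : Decidable P) (xs : List A)
  (p : Subset (length xs)) → (∀ i → V.lookup p i ≡ does (P? (lookup xs i))) →
  ∣ p ∣ ≡ length (filter P? xs)
∣p∣≡length∘filter P? [] [] _ = ≡.refl
∣p∣≡length∘filter P? (x ∷ xs) (_ ∷ p) p≡ with P? x | p≡ zero
... | yes _ | ≡.refl = ≡.cong suc (∣p∣≡length∘filter P? xs p (p≡ ∘ suc))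
... | no _  | ≡.refl = ∣p∣≡length∘filter P? xs p (p≡ ∘ suc)

Nonempty⇒1≤∣p∣ : ∀ {m} {p : Subset m} → Nonempty p → 1 ≤ ∣ p ∣
Nonempty⇒1≤∣p∣ {p = p} (i , i∈p) = ≡.subst (_≤ ∣ p ∣) (∣⁅x⁆∣≡1 i)
  (p⊆q⇒∣p∣≤∣q∣ λ j∈⁅i⁆ → ≡.subst (_∈ p) (≡.sym (x∈⁅y⁆⇒x≡y i j∈⁅i⁆)) i∈p)

IsGlobalOffensiveAlliance : ∀ {m} → (Fin m → Subset m) → Subset m → Set
IsGlobalOffensiveAlliance N S = Nonempty S × (∀ i → i ∉ S → ∣ N i ∩ ∁ S ∣ + 1 ≤ ∣ N i ∩ S ∣)

isGlobalOffensiveAlliance? : ∀ {m} (N : Fin m → Subset m) → Decidable (IsGlobalOffensiveAlliance N)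
isGlobalOffensiveAlliance? N S =
  nonempty? S ×-dec Finₚ.all? λ i → ¬? (i ∈? S) →-dec ((∣ N i ∩ ∁ S ∣ + 1) ℕₚ.≤? ∣ N i ∩ S ∣)

m+1≤n⇒m+m+1≤1+n+n : ∀ {m n} → m + 1 ≤ n → (m + m) + 1 ≤ 1 + (n + n)
m+1≤n⇒m+m+1≤1+n+n {m} {n} m+1≤n =
  ℕₚ.≤-trans (ℕₚ.≤-reflexive (ℕₚ.+-comm (m + m) 1)) (ℕₚ.+-monoʳ-≤ 1 (ℕₚ.+-mono-≤ m≤n m≤n))
  where
  m≤n : m ≤ n
  m≤n = ℕₚ.≤-trans (ℕₚ.m≤m+n m 1) m+1≤n

module ZeroDivisorGraph (R : FinCommRing) where
  open FinCommRing R using (Carrier; _≈_; _*_; 0#; 1#; _≟_; setoid; isEquivalence; refl; sym; trans;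
                            *-cong; *-identityʳ; zeroʳ; elements; complete)
  open Graph R public
  open Membership setoid using () renaming (_∈_ to _∈ₗ_)
  open Unique setoid using (Unique)

  isGOA? : Decidable IsGOA
  isGOA? = isGlobalOffensiveAlliance? N

  vertices-unique : Unique vertices
  vertices-unique = Uniqueₚ.filter⁺ setoid isVertex? (DecUniqueₚ.deduplicate-! decSetoid elements)
    where
    decSetoid : DecSetoid 0ℓ 0ℓ
    decSetoid = record { isDecEquivalence = record { isEquivalence = isEquivalence ; _≟_ = _≟_ } }

  zero-product⇒IsVertex : ∀ {x y} → ¬ x ≈ 0# → ¬ y ≈ 0# → x * y ≈ 0# → IsVertex x
  zero-product⇒IsVertex x≉0 y≉0 xy≈0 =
    x≉0 , Any.map (λ y≈z → (y≉0 ∘ trans y≈z) , trans (*-cong refl (sym y≈z)) xy≈0) (complete _)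

  IsVertex-resp : IsVertex Respects _≈_
  IsVertex-resp x≈y (x≉0 , annihilator) =
    (λ y≈0 → x≉0 (trans x≈y y≈0)) , Any.map (Product.map₂ (trans (*-cong (sym x≈y) refl))) annihilator

  IsVertex⇒∈vertices : ∀ {x} → IsVertex x → x ∈ₗ vertices
  IsVertex⇒∈vertices x-vertex = Membershipₚ.∈-filter⁺ setoid isVertex? IsVertex-resp
    (Membershipₚ.∈-deduplicate⁺ setoid _≟_ (λ y≈z x≈z → trans x≈z (sym y≈z)) (complete _)) x-vertex

  ∈vertices⇒IsVertex : ∀ {x} → x ∈ₗ vertices → IsVertex x
  ∈vertices⇒IsVertex = proj₂ ∘ Membershipₚ.∈-filter⁻ setoid isVertex? IsVertex-resp {xs = distinctElements}

  vertices-IsVertex : All IsVertex vertices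
  vertices-IsVertex = Allₚ.all-filter isVertex? distinctElements

  IsVertex-vtx : ∀ i → IsVertex (vtx i)
  IsVertex-vtx i = All.lookup vertices-IsVertex (PropMembershipₚ.∈-lookup i)

  vtx-injective : ∀ {i j} → vtx i ≈ vtx j → i ≡ j
  vtx-injective = lookup-injective setoid vertices-unique

  vtx-surjective : ∀ {x} → IsVertex x → ∃[ i ] x ≈ vtx i
  vtx-surjective x-vertex = let x∈ = IsVertex⇒∈vertices x-vertex in Any.index x∈ , Anyₚ.lookup-result x∈

  IsVertex⇒1≉0 : ∀ {x} → IsVertex x → ¬ 1# ≈ 0#
  IsVertex⇒1≉0 {x} (x≉0 , _) 1≈0 = x≉0 (begin
    x      ≈⟨ sym (*-identityʳ x) ⟩
    x * 1# ≈⟨ *-cong refl 1≈0 ⟩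
    x * 0# ≈⟨ zeroʳ x ⟩
    0#     ∎)
    where open import Relation.Binary.Reasoning.Setoid setoid

  Adj-resp : ∀ {x x′ y y′} → x ≈ x′ → y ≈ y′ → Adj x y → Adj x′ y′
  Adj-resp x≈ y≈ (x≉y , xy≈0) =
    (λ x′≈y′ → x≉y (trans x≈ (trans x′≈y′ (sym y≈)))) , trans (*-cong (sym x≈) (sym y≈)) xy≈0

  countVertices : {P : Pred Carrier 0ℓ} → Decidable P → ℕ
  countVertices P? = length (filter P? vertices)

  countNeighbours : Carrier → {P : Pred Carrier 0ℓ} → Decidable P → ℕ
  countNeighbours x P? = countVertices (λ y → adj? x y ×-dec P? y)

  countNeighbours-resp : ∀ {x x′} → x ≈ x′ → {P : Pred Carrier 0ℓ} (P? : Decidable P) →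
                         countNeighbours x P? ≡ countNeighbours x′ P?
  countNeighbours-resp x≈x′ P? = ≡.cong length (Listₚ.filter-≐ _ _
    (Product.map₁ (Adj-resp x≈x′ refl) , Product.map₁ (Adj-resp (sym x≈x′) refl)) vertices)

  vertexSet : {P : Pred Carrier 0ℓ} → Decidable P → Subset n
  vertexSet P? = V.tabulate λ j → does (P? (vtx j))

  module _ {P : Pred Carrier 0ℓ} (P? : Decidable P) where

    ∣vertexSet∣ : ∣ vertexSet P? ∣ ≡ countVertices P?
    ∣vertexSet∣ = ∣p∣≡length∘filter P? vertices (vertexSet P?) (Vecₚ.lookup∘tabulate _)

    ∈vertexSet : ∀ {i} → P (vtx i) → i ∈ vertexSet P?
    ∈vertexSet {i} Pi with P? (vtx i) in eq
    ... | yes _  = Vecₚ.lookup⇒[]= i _ (≡.trans (Vecₚ.lookup∘tabulate _ i) (≡.cong does eq))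
    ... | no ¬Pi = contradiction Pi ¬Pi

  module _ {P Q : Pred Carrier 0ℓ} (P? : Decidable P) (Q? : Decidable Q) where

    ∣vertexSet∩vertexSet∣ : ∣ vertexSet P? ∩ vertexSet Q? ∣ ≡ countVertices (λ x → P? x ×-dec Q? x)
    ∣vertexSet∩vertexSet∣ = ∣p∣≡length∘filter _ vertices (vertexSet P? ∩ vertexSet Q?) λ j →
      ≡.trans (Vecₚ.lookup-zipWith _∧_ j (vertexSet P?) (vertexSet Q?))
              (≡.cong₂ _∧_ (Vecₚ.lookup∘tabulate _ j) (Vecₚ.lookup∘tabulate _ j))

    ∣vertexSet∩∁vertexSet∣ :
      ∣ vertexSet P? ∩ ∁ (vertexSet Q?) ∣ ≡ countVertices (λ x → P? x ×-dec ¬? (Q? x))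
    ∣vertexSet∩∁vertexSet∣ = ∣p∣≡length∘filter _ vertices (vertexSet P? ∩ ∁ (vertexSet Q?)) λ j →
      ≡.trans (Vecₚ.lookup-zipWith _∧_ j (vertexSet P?) (∁ (vertexSet Q?)))
              (≡.cong₂ _∧_ (Vecₚ.lookup∘tabulate _ j)
                           (≡.trans (Vecₚ.lookup-map j not (vertexSet Q?))
                                    (≡.cong not (Vecₚ.lookup∘tabulate _ j))))

  module _ (S : Subset n) where

    Member : Pred Carrier 0ℓ
    Member x = ∃[ j ] j ∈ S × x ≈ vtx j

    member? : Decidable Member
    member? x = Finₚ.any? λ j → (j ∈? S) ×-dec (x ≟ vtx j)

    Member-resp : Member Respects _≈_
    Member-resp x≈y (j , j∈S , x≈) = j , j∈S , trans (sym x≈y) x≈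

    Member⇒IsVertex : ∀ {x} → Member x → IsVertex x
    Member⇒IsVertex (j , _ , x≈vtx) = IsVertex-resp (sym x≈vtx) (IsVertex-vtx j)

    vertexSet-member : vertexSet member? ≡ S
    vertexSet-member = ≡.trans (Vecₚ.tabulate-cong member?≡lookup) (Vecₚ.tabulate∘lookup S)
      where
      member?≡lookup : ∀ j → does (member? (vtx j)) ≡ V.lookup S j
      member?≡lookup j with V.lookup S j in eq | member? (vtx j)
      ... | true  | yes _ = ≡.refl
      ... | false | no _  = ≡.refl
      ... | true  | no ¬member = contradiction (j , Vecₚ.lookup⇒[]= j S eq , refl) ¬member
      ... | false | yes (j′ , j′∈S , vtx≈) with vtx-injective vtx≈
      ...   | ≡.refl = contradiction (≡.trans (≡.sym (Vecₚ.[]=⇒lookup j′∈S)) eq) λ ()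

    ∣S∣≡countMembers : ∣ S ∣ ≡ countVertices member?
    ∣S∣≡countMembers = ≡.trans (≡.cong ∣_∣ (≡.sym vertexSet-member)) (∣vertexSet∣ member?)

    nil2Out≡countNil2NonMembers : nil2Out S ≡ countVertices (λ x → ((x * x) ≟ 0#) ×-dec ¬? (member? x))
    nil2Out≡countNil2NonMembers = ≡.trans (≡.cong (λ T → ∣ nil2 ∩ ∁ T ∣) (≡.sym vertexSet-member))
                                          (∣vertexSet∩∁vertexSet∣ (λ x → (x * x) ≟ 0#) member?)

    IsGOA⇒countNeighbours-bound : IsGOA S → ∀ {x} → IsVertex x → ¬ Member x →
      countNeighbours x (¬? ∘ member?) + 1 ≤ countNeighbours x member?
    IsGOA⇒countNeighbours-bound (_ , offensive) {x} x-vertex x∉S with vtx-surjective x-vertex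
    ... | i , x≈vtx = ≡.subst₂ (λ o m → o + 1 ≤ m) out≡ in≡ (offensive i λ i∈S → x∉S (i , i∈S , x≈vtx))
      where
      in≡ : δ S i ≡ countNeighbours x member?
      in≡ = ≡.trans (≡.cong (λ T → δ T i) (≡.sym vertexSet-member))
                    (≡.trans (∣vertexSet∩vertexSet∣ (adj? (vtx i)) member?)
                             (countNeighbours-resp (sym x≈vtx) member?))
      out≡ : δ (∁ S) i ≡ countNeighbours x (¬? ∘ member?)
      out≡ = ≡.trans (≡.cong (λ T → δ (∁ T) i) (≡.sym vertexSet-member))
                     (≡.trans (∣vertexSet∩∁vertexSet∣ (adj? (vtx i)) member?)
                              (countNeighbours-resp (sym x≈vtx) _))

  IsGOA⇒1≤∣S∣ : ∀ S → IsGOA S → 1 ≤ ∣ S ∣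
  IsGOA⇒1≤∣S∣ _ = Nonempty⇒1≤∣p∣ ∘ proj₁

module Doubling (R : FinCommRing) where
  open FinCommRing R using (Carrier; _≈_; _*_; 0#; 1#; _≟_; setoid; refl; sym; trans; *-cong; *-comm; zeroˡ; zeroʳ)
  open ZeroDivisorGraph R

  ℤ₂×R : FinCommRing
  ℤ₂×R = ℤ₂ ×R R

  module Γ = ZeroDivisorGraph ℤ₂×R
  open FinCommRing ℤ₂×R using ()
    renaming (Carrier to Carrier₂; _≈_ to _≈₂_; setoid to setoid₂; refl to refl₂; sym to sym₂)
  open Membership setoid₂ using () renaming (_∈_ to _∈₂_; _∉_ to _∉₂_)
  open Unique setoid₂ using () renaming (Unique to Unique₂)
  open Disjointness setoid₂ using () renaming (Disjoint to Disjoint₂)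

  ι₀ ι₁ : Carrier → Carrier₂
  ι₀ x = zero , x
  ι₁ x = suc zero , x

  ι₀-IsVertex : ∀ {x} → ¬ x ≈ 0# → Γ.IsVertex (ι₀ x)
  ι₀-IsVertex {x} x≉0 = Γ.zero-product⇒IsVertex {y = ι₁ 0#} (x≉0 ∘ proj₂) (λ { (() , _) }) (≡.refl , zeroʳ x)

  ι₁0-IsVertex : ¬ 1# ≈ 0# → Γ.IsVertex (ι₁ 0#)
  ι₁0-IsVertex 1≉0 = Γ.zero-product⇒IsVertex {y = ι₀ 1#} (λ { (() , _) }) (1≉0 ∘ proj₂) (≡.refl , zeroˡ 1#)

  ι₁-IsVertex : ∀ {x} → IsVertex x → Γ.IsVertex (ι₁ x)
  ι₁-IsVertex (_ , annihilator) with Any.satisfied annihilator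
  ... | y , y≉0 , xy≈0 = Γ.zero-product⇒IsVertex {y = ι₀ y} (λ { (() , _) }) (y≉0 ∘ proj₂) (≡.refl , xy≈0)

  ι₁-IsVertex⁻ : ∀ {x} → ¬ x ≈ 0# → Γ.IsVertex (ι₁ x) → IsVertex x
  ι₁-IsVertex⁻ x≉0 (_ , annihilator) with Any.satisfied annihilator
  ... | (zero , y) , y≉0 , (_ , xy≈0) = zero-product⇒IsVertex x≉0 (y≉0 ∘ (≡.refl ,_)) xy≈0
  ... | (suc zero , _) , _ , (() , _)

  lift : Fin 2 → {Q : Pred Carrier 0ℓ} → Decidable Q → List Carrier₂
  lift c Q? = map (c ,_) (filter Q? vertices)

  module _ {Q : Pred Carrier 0ℓ} (Q? : Decidable Q) where

    lift-unique : ∀ c → Unique₂ (lift c Q?)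
    lift-unique c = Uniqueₚ.map⁺ setoid setoid₂ proj₂ (Uniqueₚ.filter⁺ setoid Q? vertices-unique)

    length-lift : ∀ c → length (lift c Q?) ≡ countVertices Q?
    length-lift c = Listₚ.length-map (c ,_) (filter Q? vertices)

    length-lift₀++lift₁ : length (lift zero Q? ++ lift (suc zero) Q?) ≡ countVertices Q? + countVertices Q?
    length-lift₀++lift₁ =
      ≡.trans (Listₚ.length-++ (lift zero Q?)) (≡.cong₂ _+_ (length-lift zero) (length-lift (suc zero)))

    lift-∈ : ∀ {c y} → y ∈₂ lift c Q? → ∃[ x ] y ≈₂ (c , x) × IsVertex x × Q x
    lift-∈ y∈ with PropMembership.find (Anyₚ.map⁻ y∈)
    ... | x , x∈ , y≈ with PropMembershipₚ.∈-filter⁻ Q? x∈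
    ...   | x∈vertices , Qx = x , y≈ , All.lookup vertices-IsVertex x∈vertices , Qx

    ∈-lift : Q Respects _≈_ → ∀ c {x} → IsVertex x → Q x → (c , x) ∈₂ lift c Q?
    ∈-lift Q-resp c x-vertex Qx = Membershipₚ.∈-map⁺ setoid setoid₂ (≡.refl ,_)
      (Membershipₚ.∈-filter⁺ setoid Q? Q-resp (IsVertex⇒∈vertices x-vertex) Qx)

    All-lift : ∀ {c} {P : Pred Carrier₂ 0ℓ} → (∀ {x} → IsVertex x → Q x → P (c , x)) → All P (lift c Q?)
    All-lift f = Allₚ.map⁺ (All.map (uncurry f)
      (All.zip (Allₚ.filter⁺ Q? vertices-IsVertex , Allₚ.all-filter Q? vertices)))

    ι₁0∉lift : ∀ c → ι₁ 0# ∉₂ lift c Q?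
    ι₁0∉lift c ι₁0∈ with lift-∈ ι₁0∈
    ... | _ , (_ , 0≈x) , (x≉0 , _) , _ = x≉0 (sym 0≈x)

  lift₀-lift₁-disjoint : ∀ {P Q : Pred Carrier 0ℓ} (P? : Decidable P) (Q? : Decidable Q) →
                         Disjoint₂ (lift zero P?) (lift (suc zero) Q?)
  lift₀-lift₁-disjoint P? Q? (y∈₀ , y∈₁) with lift-∈ P? y∈₀ | lift-∈ Q? y∈₁
  ... | _ , (y≡0 , _) , _ | _ , (y≡1 , _) , _ = contradiction (≡.trans (≡.sym y≡0) y≡1) λ ()

  module _ (S : Subset n) where

    -- S′ of the header, as a predicate on ℤ₂ × R.  It also holds at the non-vertex (0,0).
    InDoubled : Pred Carrier₂ 0ℓ
    InDoubled (zero , x)     = Member S x ⊎ x * x ≈ 0#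
    InDoubled (suc zero , x) = x ≈ 0# ⊎ Member S x

    inDoubled? : Decidable InDoubled
    inDoubled? (zero , x)     = member? S x ⊎-dec ((x * x) ≟ 0#)
    inDoubled? (suc zero , x) = (x ≟ 0#) ⊎-dec member? S x

    InDoubled-resp : InDoubled Respects _≈₂_
    InDoubled-resp {zero , _}     (≡.refl , x≈y) =
      Sum.map (Member-resp S x≈y) (trans (*-cong (sym x≈y) (sym x≈y)))
    InDoubled-resp {suc zero , _} (≡.refl , x≈y) = Sum.map (trans (sym x≈y)) (Member-resp S x≈y)

    zero-InDoubled : ∀ c {x} → x ≈ 0# → InDoubled (c , x)
    zero-InDoubled zero       {x} x≈0 = inj₂ (trans (*-cong x≈0 refl) (zeroˡ x))
    zero-InDoubled (suc zero)     x≈0 = inj₁ x≈0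

    doubled : Subset Γ.n
    doubled = Γ.vertexSet inDoubled?

    NonMemberNil2 : Pred Carrier 0ℓ
    NonMemberNil2 x = x * x ≈ 0# × ¬ Member S x

    nonMemberNil2? : Decidable NonMemberNil2
    nonMemberNil2? x = ((x * x) ≟ 0#) ×-dec ¬? (member? S x)

    NonMemberNil2-resp : NonMemberNil2 Respects _≈_
    NonMemberNil2-resp x≈y (x²≈0 , x∉S) =
      trans (*-cong (sym x≈y) (sym x≈y)) x²≈0 , x∉S ∘ Member-resp S (sym x≈y)

    ∣doubled∣≤ : ∣ doubled ∣ ≤ 1 + nil2Out S + 2 ℕ.* ∣ S ∣
    ∣doubled∣≤ = begin
      ∣ doubled ∣                  ≡⟨ Γ.∣vertexSet∣ inDoubled? ⟩
      Γ.countVertices inDoubled?  ≤⟨ length-filter-≤ setoid₂ inDoubled? InDoubled-resp Γ.vertices-unique cover ⟩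
      length candidates           ≡⟨ ≡.cong suc (≡.trans (Listₚ.length-++ nil2s)
                                       (≡.cong₂ _+_ (length-lift _ zero) (length-lift₀++lift₁ (member? S)))) ⟩
      1 + countVertices nonMemberNil2? + (countVertices (member? S) + countVertices (member? S))
        ≡⟨ ≡.sym (≡.cong₂ (λ r s → 1 + r + (s + s)) (nil2Out≡countNil2NonMembers S) (∣S∣≡countMembers S)) ⟩
      1 + nil2Out S + (∣ S ∣ + ∣ S ∣)
        ≡⟨ ≡.cong (λ t → 1 + nil2Out S + (∣ S ∣ + t)) (≡.sym (ℕₚ.+-identityʳ ∣ S ∣)) ⟩
      1 + nil2Out S + 2 ℕ.* ∣ S ∣  ∎
      where
      open ℕₚ.≤-Reasoning
      nil2s members : List Carrier₂
      nil2s = lift zero nonMemberNil2?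
      members = lift zero (member? S) ++ lift (suc zero) (member? S)
      candidates : List Carrier₂
      candidates = ι₁ 0# ∷ nil2s ++ members
      member∈ : ∀ c {x} → Member S x → (c , x) ∈₂ lift c (member? S)
      member∈ c x∈S = ∈-lift (member? S) (Member-resp S) c (Member⇒IsVertex S x∈S) x∈S
      cover : ∀ {y} → y ∈₂ Γ.vertices → InDoubled y → y ∈₂ candidates
      cover {zero , x} y∈ x-in with member? S x
      ... | yes x∈S = there (∈-++⁺ʳ setoid₂ nil2s (∈-++⁺ˡ setoid₂ (member∈ zero x∈S)))
      ... | no x∉S = there (∈-++⁺ˡ setoid₂ (∈-lift nonMemberNil2? NonMemberNil2-resp zero
                                              (zero-product⇒IsVertex x≉0 x≉0 x²≈0) (x²≈0 , x∉S)))
        where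
        x≉0 : ¬ x ≈ 0#
        x≉0 = proj₁ (Γ.∈vertices⇒IsVertex y∈) ∘ (≡.refl ,_)
        x²≈0 : x * x ≈ 0#
        x²≈0 = Sum.[ (λ x∈S → contradiction x∈S x∉S) , (λ x²≈0 → x²≈0) ] x-in
      cover {suc zero , x} _ (inj₁ x≈0) = here (≡.refl , x≈0)
      cover {suc zero , x} _ (inj₂ x∈S) =
        there (∈-++⁺ʳ setoid₂ nil2s (∈-++⁺ʳ setoid₂ (lift zero (member? S)) (member∈ (suc zero) x∈S)))

    Neighbour OutsideNeighbour : Carrier₂ → Pred Carrier₂ 0ℓ
    Neighbour y z = Γ.Adj y z × InDoubled z
    OutsideNeighbour y z = Γ.Adj y z × ¬ InDoubled z

    Neighbour-resp : ∀ y → Neighbour y Respects _≈₂_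
    Neighbour-resp y z≈ (adj , z-in) = Γ.Adj-resp refl₂ z≈ adj , InDoubled-resp z≈ z-in

    OutsideNeighbour-resp : ∀ y → OutsideNeighbour y Respects _≈₂_
    OutsideNeighbour-resp y z≈ (adj , z-out) = Γ.Adj-resp refl₂ z≈ adj , z-out ∘ InDoubled-resp (sym₂ z≈)

    countOutsideNeighbours-≤ : ∀ {y L} →
                               (∀ {z} → z ∈₂ Γ.vertices → Γ.Adj y z → ¬ InDoubled z → z ∈₂ L) →
                               Γ.countNeighbours y (¬? ∘ inDoubled?) ≤ length L
    countOutsideNeighbours-≤ {y} into =
      length-filter-≤ setoid₂ _ (OutsideNeighbour-resp y) Γ.vertices-unique λ z∈ (adj , z-out) →
        into z∈ adj z-out

    ≤-countNeighbours : ∀ {y L} → Unique₂ L → All (λ z → Γ.IsVertex z × Neighbour y z) L →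
                        length L ≤ Γ.countNeighbours y inDoubled?
    ≤-countNeighbours {y} L! neighbours = ≤-length-filter setoid₂ _ (Neighbour-resp y) L! λ z∈ →
      let _ , z′∈ , z≈z′ = PropMembership.find z∈
          z′-vertex , z′-neighbour = All.lookup neighbours z′∈
      in Γ.IsVertex⇒∈vertices (Γ.IsVertex-resp (sym₂ z≈z′) z′-vertex) ,
         Neighbour-resp y (sym₂ z≈z′) z′-neighbour

    memberNeighbour? : ∀ x → Decidable (λ v → Adj x v × Member S v)
    nonMemberNeighbour? : ∀ x → Decidable (λ v → Adj x v × ¬ Member S v)
    memberNeighbour? x v = adj? x v ×-dec member? S v
    nonMemberNeighbour? x v = adj? x v ×-dec ¬? (member? S v)

    nonMemberNeighbour-resp : ∀ x → (λ v → Adj x v × ¬ Member S v) Respects _≈_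
    nonMemberNeighbour-resp x v≈ (adj , v∉S) = Adj-resp refl v≈ adj , v∉S ∘ Member-resp S (sym v≈)

    annihilator-IsVertex : ∀ {c x w} → ¬ x ≈ 0# → x * w ≈ 0# → ¬ InDoubled (c , w) → IsVertex w
    annihilator-IsVertex {c} {x} {w} x≉0 xw≈0 w-out =
      zero-product⇒IsVertex (w-out ∘ zero-InDoubled c) x≉0 (trans (*-comm w x) xw≈0)

    ι₀-regular-offensive : ¬ 1# ≈ 0# → ∀ {x} → ¬ x ≈ 0# → ¬ IsVertex x →
      Γ.countNeighbours (ι₀ x) (¬? ∘ inDoubled?) + 1 ≤ Γ.countNeighbours (ι₀ x) inDoubled?
    ι₀-regular-offensive 1≉0 {x} x≉0 x-regular = ℕₚ.≤-trans
      (ℕₚ.+-monoˡ-≤ 1 (countOutsideNeighbours-≤ {L = []} no-outside-neighbour))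
      (≤-countNeighbours ([] ∷ [])
        ((ι₁0-IsVertex 1≉0 , ((λ { (() , _) }) , (≡.refl , zeroʳ x)) , inj₁ refl) ∷ []))
      where
      no-outside-neighbour : ∀ {z} → z ∈₂ Γ.vertices → Γ.Adj (ι₀ x) z → ¬ InDoubled z → z ∈₂ []
      no-outside-neighbour {c , w} _ (_ , _ , xw≈0) w-out = contradiction (zero-InDoubled c w≈0) w-out
        where
        w≈0 : w ≈ 0#
        w≈0 = decidable-stable (w ≟ 0#) λ w≉0 → x-regular (zero-product⇒IsVertex x≉0 w≉0 xw≈0)

    ι₀-countOutsideNeighbours-≤ : ∀ {x} → ¬ x ≈ 0# → ¬ x * x ≈ 0# →
      Γ.countNeighbours (ι₀ x) (¬? ∘ inDoubled?) ≤
        countNeighbours x (¬? ∘ member? S) + countNeighbours x (¬? ∘ member? S)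
    ι₀-countOutsideNeighbours-≤ {x} x≉0 x²≉0 =
      ℕₚ.≤-trans (countOutsideNeighbours-≤ cover)
                 (ℕₚ.≤-reflexive (length-lift₀++lift₁ (nonMemberNeighbour? x)))
      where
      cover : ∀ {z} → z ∈₂ Γ.vertices → Γ.Adj (ι₀ x) z → ¬ InDoubled z →
              z ∈₂ lift zero (nonMemberNeighbour? x) ++ lift (suc zero) (nonMemberNeighbour? x)
      cover {zero , w} _ (ι₀x≉ι₀w , _ , xw≈0) w-out = ∈-++⁺ˡ setoid₂
        (∈-lift _ (nonMemberNeighbour-resp x) zero (annihilator-IsVertex {zero} x≉0 xw≈0 w-out)
          ((ι₀x≉ι₀w ∘ (≡.refl ,_) , xw≈0) , w-out ∘ inj₁))
      cover {suc zero , w} _ (_ , _ , xw≈0) w-out = ∈-++⁺ʳ setoid₂ (lift zero (nonMemberNeighbour? x))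
        (∈-lift _ (nonMemberNeighbour-resp x) (suc zero) (annihilator-IsVertex {suc zero} x≉0 xw≈0 w-out)
          (((λ x≈w → x²≉0 (trans (*-cong refl x≈w) xw≈0)) , xw≈0) , w-out ∘ inj₂))

    ι₀-≤-countNeighbours : ∀ {x} → IsVertex x →
      1 + (countNeighbours x (member? S) + countNeighbours x (member? S)) ≤ Γ.countNeighbours (ι₀ x) inDoubled?
    ι₀-≤-countNeighbours {x} x-vertex = ℕₚ.≤-trans
      (ℕₚ.≤-reflexive (≡.cong suc (≡.sym (length-lift₀++lift₁ (memberNeighbour? x)))))
      (≤-countNeighbours unique neighbours)
      where
      inside₀ inside₁ : List Carrier₂
      inside₀ = lift zero (memberNeighbour? x)
      inside₁ = lift (suc zero) (memberNeighbour? x)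
      unique : Unique₂ (ι₁ 0# ∷ inside₀ ++ inside₁)
      unique = ∉⇒All[≉] setoid₂ (Sum.[ ι₁0∉lift _ zero , ι₁0∉lift _ (suc zero) ]
                                 ∘ ∈-++⁻ setoid₂ inside₀)
             ∷ Uniqueₚ.++⁺ setoid₂ (lift-unique _ zero) (lift-unique _ (suc zero)) (lift₀-lift₁-disjoint _ _)
      neighbours : All (λ z → Γ.IsVertex z × Neighbour (ι₀ x) z) (ι₁ 0# ∷ inside₀ ++ inside₁)
      neighbours =
        (ι₁0-IsVertex (IsVertex⇒1≉0 x-vertex) , ((λ { (() , _) }) , (≡.refl , zeroʳ x)) , inj₁ refl) ∷
        Allₚ.++⁺ (All-lift _ λ (w≉0 , _) ((x≉w , xw≈0) , w∈S) →
                    ι₀-IsVertex w≉0 , (x≉w ∘ proj₂ , (≡.refl , xw≈0)) , inj₁ w∈S)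
                 (All-lift _ λ w-vertex ((_ , xw≈0) , w∈S) →
                    ι₁-IsVertex w-vertex , ((λ { (() , _) }) , (≡.refl , xw≈0)) , inj₂ w∈S)

    ι₀-vertex-offensive : IsGOA S → ∀ {x} → IsVertex x → ¬ Member S x → ¬ x * x ≈ 0# →
      Γ.countNeighbours (ι₀ x) (¬? ∘ inDoubled?) + 1 ≤ Γ.countNeighbours (ι₀ x) inDoubled?
    ι₀-vertex-offensive S-GOA {x} x-vertex@(x≉0 , _) x∉S x²≉0 = begin
      Γ.countNeighbours (ι₀ x) (¬? ∘ inDoubled?) + 1
        ≤⟨ ℕₚ.+-monoˡ-≤ 1 (ι₀-countOutsideNeighbours-≤ x≉0 x²≉0) ⟩
      (countNeighbours x (¬? ∘ member? S) + countNeighbours x (¬? ∘ member? S)) + 1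
        ≤⟨ m+1≤n⇒m+m+1≤1+n+n (IsGOA⇒countNeighbours-bound S S-GOA x-vertex x∉S) ⟩
      1 + (countNeighbours x (member? S) + countNeighbours x (member? S))
        ≤⟨ ι₀-≤-countNeighbours x-vertex ⟩
      Γ.countNeighbours (ι₀ x) inDoubled?  ∎
      where open ℕₚ.≤-Reasoning

    ι₁-countOutsideNeighbours-≤ : ∀ {x} → ¬ x ≈ 0# →
      Γ.countNeighbours (ι₁ x) (¬? ∘ inDoubled?) ≤ countNeighbours x (¬? ∘ member? S)
    ι₁-countOutsideNeighbours-≤ {x} x≉0 =
      ℕₚ.≤-trans (countOutsideNeighbours-≤ cover) (ℕₚ.≤-reflexive (length-lift _ zero))
      where
      cover : ∀ {z} → z ∈₂ Γ.vertices → Γ.Adj (ι₁ x) z → ¬ InDoubled z →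
              z ∈₂ lift zero (nonMemberNeighbour? x)
      cover {zero , w} _ (_ , _ , xw≈0) w-out =
        ∈-lift _ (nonMemberNeighbour-resp x) zero (annihilator-IsVertex {zero} x≉0 xw≈0 w-out)
          (((λ x≈w → w-out (inj₂ (trans (*-cong (sym x≈w) refl) xw≈0))) , xw≈0) , w-out ∘ inj₁)
      cover {suc zero , w} _ (_ , () , _) _

    ι₁-≤-countNeighbours : ∀ x → countNeighbours x (member? S) ≤ Γ.countNeighbours (ι₁ x) inDoubled?
    ι₁-≤-countNeighbours x = ℕₚ.≤-trans (ℕₚ.≤-reflexive (≡.sym (length-lift _ zero)))
      (≤-countNeighbours (lift-unique _ zero) (All-lift (memberNeighbour? x) λ (w≉0 , _) ((_ , xw≈0) , w∈S) →
        ι₀-IsVertex w≉0 , ((λ { (() , _) }) , (≡.refl , xw≈0)) , inj₁ w∈S))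

    ι₁-offensive : IsGOA S → ∀ {x} → Γ.IsVertex (ι₁ x) → ¬ InDoubled (ι₁ x) →
      Γ.countNeighbours (ι₁ x) (¬? ∘ inDoubled?) + 1 ≤ Γ.countNeighbours (ι₁ x) inDoubled?
    ι₁-offensive S-GOA {x} ι₁x-vertex x-out = begin
      Γ.countNeighbours (ι₁ x) (¬? ∘ inDoubled?) + 1
        ≤⟨ ℕₚ.+-monoˡ-≤ 1 (ι₁-countOutsideNeighbours-≤ x≉0) ⟩
      countNeighbours x (¬? ∘ member? S) + 1
        ≤⟨ IsGOA⇒countNeighbours-bound S S-GOA x-vertex (x-out ∘ inj₂) ⟩
      countNeighbours x (member? S)                    ≤⟨ ι₁-≤-countNeighbours x ⟩
      Γ.countNeighbours (ι₁ x) inDoubled?              ∎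
      where
      open ℕₚ.≤-Reasoning
      x≉0 : ¬ x ≈ 0#
      x≉0 = x-out ∘ inj₁
      x-vertex : IsVertex x
      x-vertex = ι₁-IsVertex⁻ x≉0 ι₁x-vertex

    doubled-IsGOA : IsGOA S → Γ.IsGOA doubled
    doubled-IsGOA S-GOA@((j , _) , _) = nonempty , offensive
      where
      1≉0 : ¬ 1# ≈ 0#
      1≉0 = IsVertex⇒1≉0 (IsVertex-vtx j)
      nonempty : Nonempty doubled
      nonempty with Γ.vtx-surjective (ι₁0-IsVertex 1≉0)
      ... | k , ι₁0≈vtx = k , Γ.∈vertexSet inDoubled? (InDoubled-resp ι₁0≈vtx (inj₁ refl))
      offensive-at : ∀ {y} → Γ.IsVertex y → ¬ InDoubled y →
                     Γ.countNeighbours y (¬? ∘ inDoubled?) + 1 ≤ Γ.countNeighbours y inDoubled?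
      offensive-at {zero , x} y-vertex y-out with isVertex? x
      ... | no x-regular = ι₀-regular-offensive 1≉0 (proj₁ y-vertex ∘ (≡.refl ,_)) x-regular
      ... | yes x-vertex = ι₀-vertex-offensive S-GOA x-vertex (y-out ∘ inj₁) (y-out ∘ inj₂)
      offensive-at {suc zero , x} y-vertex y-out = ι₁-offensive S-GOA y-vertex y-out
      offensive : ∀ k → k ∉ doubled → Γ.δ (∁ doubled) k + 1 ≤ Γ.δ doubled k
      offensive k k∉ = ≡.subst₂ (λ o m → o + 1 ≤ m)
        (≡.sym (Γ.∣vertexSet∩∁vertexSet∣ (Γ.adj? (Γ.vtx k)) inDoubled?))
        (≡.sym (Γ.∣vertexSet∩vertexSet∣ (Γ.adj? (Γ.vtx k)) inDoubled?))
        (offensive-at (Γ.IsVertex-vtx k) (k∉ ∘ Γ.∈vertexSet inDoubled?))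

open import Data.Nat using (_*_)

γ^o[ℤ₂×R]≤1+r+2γ^o[R] : ∀ (R : FinCommRing) {g g′ r} → Graph.IsGammaO R g → Graph.IsGammaO (ℤ₂ ×R R) g′ →
                         Graph.IsMinNil2 R r → g′ ≤ 1 + r + 2 * g
γ^o[ℤ₂×R]≤1+r+2γ^o[R] R {g} {g′} {r}
  ((S₀ , S₀-GOA , ∣S₀∣≡g) , _) (_ , minimal′) ((S , (S-GOA , minimal) , nil2Out≡r) , _) = begin
    g′                         ≤⟨ minimal′ (doubled S) (doubled-IsGOA S S-GOA) ⟩
    ∣ doubled S ∣              ≤⟨ ∣doubled∣≤ S ⟩
    1 + nil2Out S + 2 * ∣ S ∣  ≤⟨ ℕₚ.+-mono-≤ (ℕₚ.≤-reflexive (≡.cong suc nil2Out≡r))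
                                             (ℕₚ.*-monoʳ-≤ 2 (≡.subst (∣ S ∣ ≤_) ∣S₀∣≡g (minimal S₀ S₀-GOA))) ⟩
    1 + r + 2 * g              ∎
  where
  open ℕₚ.≤-Reasoning
  open Graph R using (nil2Out)
  open Doubling R

module Sharpness where
  module Γ₈ = ZeroDivisorGraph ℤ₈
  open Doubling ℤ₈

  -- The vertices of Γ(ℤ₈) are 2, 4, 6 in this order, so S₈ = {4}.
  S₈ : Subset Γ₈.n
  S₈ = ⁅ suc zero ⁆

  S₈-GOA : Γ₈.IsGOA S₈
  S₈-GOA = toWitness {a? = Γ₈.isGOA? S₈} _

  γ^o[ℤ₈]≡1 : Γ₈.IsGammaO 1
  γ^o[ℤ₈]≡1 = (S₈ , S₈-GOA , ≡.refl) , Γ₈.IsGOA⇒1≤∣S∣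

  r[ℤ₈]≡0 : Γ₈.IsMinNil2 0
  r[ℤ₈]≡0 = (S₈ , (S₈-GOA , Γ₈.IsGOA⇒1≤∣S∣) , ≡.refl) , λ _ _ → z≤n

  -- Evaluating Γ.N inside the search below is far too slow, so the neighbourhoods are written out once.
  private
    pattern O = outside
    pattern I = inside

  neighbourhoods : Vec (Subset 11) 11
  neighbourhoods =
    (O ∷ O ∷ O ∷ O ∷ O ∷ O ∷ O ∷ I ∷ O ∷ O ∷ O ∷ []) ∷
    (O ∷ O ∷ O ∷ I ∷ O ∷ O ∷ O ∷ I ∷ O ∷ I ∷ O ∷ []) ∷
    (O ∷ O ∷ O ∷ O ∷ O ∷ O ∷ O ∷ I ∷ O ∷ O ∷ O ∷ []) ∷
    (O ∷ I ∷ O ∷ O ∷ O ∷ I ∷ O ∷ I ∷ I ∷ I ∷ I ∷ []) ∷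
    (O ∷ O ∷ O ∷ O ∷ O ∷ O ∷ O ∷ I ∷ O ∷ O ∷ O ∷ []) ∷
    (O ∷ O ∷ O ∷ I ∷ O ∷ O ∷ O ∷ I ∷ O ∷ I ∷ O ∷ []) ∷
    (O ∷ O ∷ O ∷ O ∷ O ∷ O ∷ O ∷ I ∷ O ∷ O ∷ O ∷ []) ∷
    (I ∷ I ∷ I ∷ I ∷ I ∷ I ∷ I ∷ O ∷ O ∷ O ∷ O ∷ []) ∷
    (O ∷ O ∷ O ∷ I ∷ O ∷ O ∷ O ∷ O ∷ O ∷ O ∷ O ∷ []) ∷
    (O ∷ I ∷ O ∷ I ∷ O ∷ I ∷ O ∷ O ∷ O ∷ O ∷ O ∷ []) ∷
    (O ∷ O ∷ O ∷ I ∷ O ∷ O ∷ O ∷ O ∷ O ∷ O ∷ O ∷ []) ∷ []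

  N≡neighbourhoods : ∀ i → Γ.N i ≡ V.lookup neighbourhoods i
  N≡neighbourhoods =
    toWitness {a? = Finₚ.all? λ i → Vecₚ.≡-dec Bool._≟_ (Γ.N i) (V.lookup neighbourhoods i)} _

  no-alliance-below-3 : ¬ ∃ λ S → IsGlobalOffensiveAlliance (V.lookup neighbourhoods) S × ∣ S ∣ < 3
  no-alliance-below-3 = toWitnessFalse
    {a? = anySubset? λ S → isGlobalOffensiveAlliance? (V.lookup neighbourhoods) S ×-dec (∣ S ∣ ℕₚ.<? 3)} _

  γ^o[ℤ₂×ℤ₈]≡3 : Γ.IsGammaO 3
  γ^o[ℤ₂×ℤ₈]≡3 = (doubled S₈ , doubled-IsGOA S₈ S₈-GOA , ≡.refl) , λ S (S-nonempty , offensive) →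
    ℕₚ.≮⇒≥ λ ∣S∣<3 → no-alliance-below-3 (S , (S-nonempty , λ i i∉S →
      ≡.subst (λ M → ∣ M ∩ ∁ S ∣ + 1 ≤ ∣ M ∩ S ∣) (N≡neighbourhoods i) (offensive i i∉S)) , ∣S∣<3)

theorem2p8 :
  ((R : FinCommRing) → ¬ Graph.IsField R →
    (g g′ r : ℕ) →
    Graph.IsGammaO R g →
    Graph.IsGammaO (ℤ₂ ×R R) g′ →
    Graph.IsMinNil2 R r →
    g′ ≤ 1 + r + 2 * g)
  ×
  (∃[ g ] ∃[ g′ ] ∃[ r ]
    (Graph.IsGammaO ℤ₈ g × Graph.IsGammaO (ℤ₂ ×R ℤ₈) g′ × Graph.IsMinNil2 ℤ₈ r
      × g′ ≡ 1 + r + 2 * g))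
theorem2p8 =
  (λ R _ _ _ _ → γ^o[ℤ₂×R]≤1+r+2γ^o[R] R) ,
  (1 , 3 , 0 , Sharpness.γ^o[ℤ₈]≡1 , Sharpness.γ^o[ℤ₂×ℤ₈]≡3 , Sharpness.r[ℤ₈]≡0 , ≡.refl)
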